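{- Let $R$ be an $n$-ary relation on $\mathbb{Q}^k$. If $R$ is cyclic and preserved by $\min$, then $R$ contains a loop.
   Context: An $n$-ary relation on $\mathbb{Q}^k$ is a nonempty set $R$ of tuples $(t_1,\dots,t_n)$ with $t_i\in\mathbb{Q}^k$. $R$ is cyclic if it is invariant under cyclic shifts of the $n$ coordinates. $\min$ is the binary minimum on $\mathbb{Q}$ applied componentwise; preserved means closed under it. A loop in $R$ is a tuple $(a,\dots,a)\in R$. -}

module Defs where

open import Data.Nat using (ℕ)
open import Data.Rational using (ℚ; _⊓_)
open import Data.Vec using (Vec; []; _∷_; zipWith; replicate; _∷ʳ_)
open import Data.Product using (∃)

Point : ℕ → Set
Point k = Vec ℚ k

Tuple : ℕ → ℕ → Set
Tuple n k = Vec (Point k) n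

Rel : ℕ → ℕ → Set₁
Rel n k = Tuple n k → Set

Nonempty : ∀ {n k} → Rel n k → Set
Nonempty R = ∃ λ t → R t

shift : ∀ {A : Set} {n} → Vec A n → Vec A n
shift [] = []
shift (x ∷ xs) = xs ∷ʳ x

Cyclic : ∀ {n k} → Rel n k → Set
Cyclic R = ∀ t → R t → R (shift t)

minPt : ∀ {k} → Point k → Point k → Point k
minPt = zipWith _⊓_

minTuple : ∀ {n k} → Tuple n k → Tuple n k → Tuple n k
minTuple = zipWith minPt

PreservedByMin : ∀ {n k} → Rel n k → Set
PreservedByMin R = ∀ s t → R s → R t → R (minTuple s t)

HasLoop : ∀ {n k} → Rel n k → Set
HasLoop {n} R = ∃ λ a → R (replicate n a)

{-# OPTIONS --safe #-}
-- Take any t ∈ R and form u = t ∧ shift t ∧ ⋯ ∧ shiftⁿ⁻¹ t, with ∧ the coordinatewise min. Closure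
-- under shift and min puts u in R; since shiftⁿ = id and ∧ is commutative and associative,
-- shift u = u, and a tuple fixed by the cyclic shift is constant, i.e. a loop.
module Submission where

open import Defs
open import Algebra.Core using (Op₂)
open import Data.List as List using (List; _++_; [_])
import Data.List.Properties as Listₚ
open import Data.List.Properties using (++-assoc; ++-identityʳ)
open import Data.Nat using (ℕ; zero; suc)
open import Data.Nat.GeneralisedArithmetic using (iterate)
open import Data.Product using (_,_)
open import Data.Rational using (0ℚ)
open import Data.Rational.Properties using (⊓-comm; ⊓-assoc)
open import Data.Vec using (Vec; []; _∷_; _∷ʳ_; zipWith; replicate; head; toList)
open import Data.Vec.Properties
  using (toList-∷ʳ; toList-injective; length-toList; ∷-injective; zipWith-comm; zipWith-assoc; cast-is-id)
open import Function.Base using (_∘_)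
open import Relation.Binary.PropositionalEquality using (_≡_; refl; sym; trans; cong; subst; module ≡-Reasoning)
open ≡-Reasoning

private
  variable
    A : Set
    n : ℕ

zipWith-∷ʳ : ∀ {B C : Set} (f : A → B → C) (xs : Vec A n) (ys : Vec B n) x y →
             zipWith f (xs ∷ʳ x) (ys ∷ʳ y) ≡ zipWith f xs ys ∷ʳ f x y
zipWith-∷ʳ f []       []       x y = refl
zipWith-∷ʳ f (a ∷ xs) (b ∷ ys) x y = cong (f a b ∷_) (zipWith-∷ʳ f xs ys x y)

shift-zipWith : ∀ {B C : Set} (f : A → B → C) (xs : Vec A n) (ys : Vec B n) →
                shift (zipWith f xs ys) ≡ zipWith f (shift xs) (shift ys)
shift-zipWith f []       []       = refl
shift-zipWith f (x ∷ xs) (y ∷ ys) = sym (zipWith-∷ʳ f xs ys x y)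

toList-iterate-shift : (xs ys : List A) (v : Vec A n) → toList v ≡ xs ++ ys →
                       toList (iterate shift v (List.length xs)) ≡ ys ++ xs
toList-iterate-shift List.[] ys v v≡ys = trans v≡ys (sym (++-identityʳ ys))
toList-iterate-shift (x List.∷ xs) ys (w ∷ ws) v≡x∷xs++ys
  with refl , ws≡xs++ys ← Listₚ.∷-injective v≡x∷xs++ys = begin
    toList (iterate shift (ws ∷ʳ w) (List.length xs))
  ≡⟨ toList-iterate-shift xs (ys ++ [ w ]) (ws ∷ʳ w) ws∷ʳw≡xs++ys∷ʳw ⟩
    (ys ++ [ w ]) ++ xs
  ≡⟨ ++-assoc ys [ w ] xs ⟩
    ys ++ w List.∷ xs
  ∎
  where
  ws∷ʳw≡xs++ys∷ʳw : toList (ws ∷ʳ w) ≡ xs ++ (ys ++ [ w ])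
  ws∷ʳw≡xs++ys∷ʳw = begin
    toList (ws ∷ʳ w)       ≡⟨ toList-∷ʳ w ws ⟩
    toList ws ++ [ w ]     ≡⟨ cong (_++ [ w ]) ws≡xs++ys ⟩
    (xs ++ ys) ++ [ w ]    ≡⟨ ++-assoc xs ys [ w ] ⟩
    xs ++ (ys ++ [ w ])    ∎

iterate-shift-periodic : (v : Vec A n) → iterate shift v n ≡ v
iterate-shift-periodic {n = n} v =
  trans (sym (cast-is-id refl _)) (toList-injective refl _ v toList-equal)
  where
  toList-equal : toList (iterate shift v n) ≡ toList v
  toList-equal = begin
    toList (iterate shift v n)                         ≡⟨ cong (toList ∘ iterate shift v) (sym (length-toList v)) ⟩
    toList (iterate shift v (List.length (toList v)))  ≡⟨ toList-iterate-shift (toList v) List.[] v (sym (++-identityʳ (toList v))) ⟩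
    toList v                                           ∎

∷ʳ≡∷⇒replicate : (x : A) (xs : Vec A n) → xs ∷ʳ x ≡ x ∷ xs → xs ≡ replicate n x
∷ʳ≡∷⇒replicate x []       _  = refl
∷ʳ≡∷⇒replicate x (y ∷ ys) eq with refl , ys∷ʳy≡y∷ys ← ∷-injective eq =
  cong (y ∷_) (∷ʳ≡∷⇒replicate y ys ys∷ʳy≡y∷ys)

shift-fixed⇒replicate : (v : Vec A (suc n)) → shift v ≡ v → v ≡ replicate (suc n) (head v)
shift-fixed⇒replicate (x ∷ xs) eq = cong (x ∷_) (∷ʳ≡∷⇒replicate x xs eq)

module OrbitMeet {A : Set} (_∙_ : Op₂ A) where

  infixl 7 _∧_
  _∧_ : Vec A n → Vec A n → Vec A n
  _∧_ = zipWith _∙_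

  orbitMeet : ℕ → Vec A n → Vec A n
  orbitMeet zero    t = t
  orbitMeet (suc m) t = t ∧ orbitMeet m (shift t)

  orbitMeet-closed : (P : Vec A n → Set) → (∀ t → P t → P (shift t)) →
                     (∀ s t → P s → P t → P (s ∧ t)) → ∀ m t → P t → P (orbitMeet m t)
  orbitMeet-closed P shift-closed ∧-closed zero    t Pt = Pt
  orbitMeet-closed P shift-closed ∧-closed (suc m) t Pt =
    ∧-closed t _ Pt (orbitMeet-closed P shift-closed ∧-closed m (shift t) (shift-closed t Pt))

  shift-orbitMeet : ∀ m (t : Vec A n) → shift (orbitMeet m t) ≡ orbitMeet m (shift t)
  shift-orbitMeet zero    t = refl
  shift-orbitMeet (suc m) t =
    trans (shift-zipWith _∙_ t _) (cong (shift t ∧_) (shift-orbitMeet m (shift t)))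

  module _ (∙-comm : ∀ x y → x ∙ y ≡ y ∙ x) (∙-assoc : ∀ x y z → (x ∙ y) ∙ z ≡ x ∙ (y ∙ z)) where

    orbitMeet-suc : ∀ m (t : Vec A n) → orbitMeet (suc m) t ≡ orbitMeet m t ∧ iterate shift t (suc m)
    orbitMeet-suc zero    t = refl
    orbitMeet-suc (suc m) t = begin
      t ∧ orbitMeet (suc m) (shift t)                                     ≡⟨ cong (t ∧_) (orbitMeet-suc m (shift t)) ⟩
      t ∧ (orbitMeet m (shift t) ∧ iterate shift t (suc (suc m)))         ≡⟨ zipWith-assoc ∙-assoc t _ _ ⟨
      t ∧ orbitMeet m (shift t) ∧ iterate shift t (suc (suc m))           ∎

    orbitMeet-shift-invariant : ∀ m (t : Vec A (suc m)) → orbitMeet m (shift t) ≡ orbitMeet m t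
    orbitMeet-shift-invariant zero    t = iterate-shift-periodic t
    orbitMeet-shift-invariant (suc m) t = begin
      orbitMeet (suc m) (shift t)                                ≡⟨ orbitMeet-suc m (shift t) ⟩
      orbitMeet m (shift t) ∧ iterate shift t (suc (suc m))      ≡⟨ cong (orbitMeet m (shift t) ∧_) (iterate-shift-periodic t) ⟩
      orbitMeet m (shift t) ∧ t                                  ≡⟨ zipWith-comm ∙-comm _ t ⟩
      orbitMeet (suc m) t                                        ∎

    shift-fixes-orbitMeet : ∀ m (t : Vec A (suc m)) → shift (orbitMeet m t) ≡ orbitMeet m t
    shift-fixes-orbitMeet m t = trans (shift-orbitMeet m t) (orbitMeet-shift-invariant m t)

minPt-comm : ∀ {k} (x y : Point k) → minPt x y ≡ minPt y x
minPt-comm = zipWith-comm ⊓-comm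

minPt-assoc : ∀ {k} (x y z : Point k) → minPt (minPt x y) z ≡ minPt x (minPt y z)
minPt-assoc = zipWith-assoc ⊓-assoc

open OrbitMeet using (orbitMeet; orbitMeet-closed; shift-fixes-orbitMeet)

lemma5p2 : (n k : ℕ) (R : Rel n k) → Nonempty R → Cyclic R → PreservedByMin R → HasLoop R
lemma5p2 zero    k R ([] , []∈R) _ _ = replicate k 0ℚ , []∈R
lemma5p2 (suc m) k R (t , t∈R) cyclic preserved =
  head u , subst R (shift-fixed⇒replicate u u-shift-fixed) u∈R
  where
  u : Tuple (suc m) k
  u = orbitMeet minPt m t

  u∈R : R u
  u∈R = orbitMeet-closed minPt R cyclic preserved m t t∈R

  u-shift-fixed : shift u ≡ u
  u-shift-fixed = shift-fixes-orbitMeet minPt minPt-comm minPt-assoc m t
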